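{- Let $\mathbf A,\mathbf H,\mathbf L,\mathbf B$ be odd FL$_e$-algebras with $\mathbf H\leq\mathbf A_{\mathbf{gr}}$. Let $\mathbf C$ be the type I partial lexicographic product of $\mathbf A,\mathbf H,\mathbf L$. Then the type II partial lexicographic product of $\mathbf C$ and $\mathbf B$ is well-defined if and only if the type I partial lexicographic product of $\mathbf A$, $\mathbf H$ and (the type II partial lexicographic product of $\mathbf L$ and $\mathbf B$) is well-defined, and in that case the two algebras are isomorphic.
   Context: An FL$_e$-algebra is a structure $(X,\wedge,\vee,\ast,\to_\ast,t,f)$ where $(X,\wedge,\vee)$ is a lattice with order $\leq$, $(X,\ast,t)$ is a commutative monoid which is residuated ($x\ast y\leq z$ iff $x\to_\ast z\geq y$), and $f\in X$ is a constant. Put $\neg x=x\to_\ast f$; it is involutive if $\neg\neg x=x$ and odd if moreover $t=f$. The group part $X_{gr}$ is the set of invertible elements, the universe of a subalgebra $\mathbf X_{\mathbf{gr}}$; $\mathbf H\leq\mathbf A_{\mathbf{gr}}$ means $\mathbf H$ is a subalgebra of $\mathbf A$ contained in $A_{gr}$. For a chain and $x$ in it, $x_\downarrow$ is the largest element smaller than $x$ if it exists, else $x$; $x_\uparrow$ dually. $Z\subseteq X$ is discretely embedded into $X$ if for every $x\in Z$, $x\notin\{x_\uparrow,x_\downarrow\}\subseteq Z$. Type I partial lexicographic product of an odd $\mathbf X$, $\mathbf V\leq\mathbf X_{\mathbf{gr}}$, and an involutive $\mathbf Y$: add to $Y$ a new top $\top$ which is an annihilator, then a new bottom $\bot$ which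 is an annihilator, with $\neg\bot=\top$, $\neg\top=\bot$. Universe $(V\times(Y\cup\{\top,\bot\}))\cup((X\setminus V)\times\{\bot\})$ with lexicographic order, coordinatewise monoid operation, unit $(t_X,t_Y)$, constant $(f_X,f_Y)$, residual $a\to b=\neg(a\ast\neg b)$ where $\neg(x,y)=(\neg x,\bot)$ if $x\notin V$ and $(\neg x,\neg y)$ if $x\in V$. Type II partial lexicographic product of an odd $\mathbf X$ and an involutive $\mathbf Y$: it is well-defined exactly when $X_{gr}$ is discretely embedded into $X$. Add to $Y$ a new top $\top$ which is an annihilator. Universe $(X\times\{\top\})\cup(X_{gr}\times Y)$ with lexicographic order, coordinatewise monoid operation, unit $(t_X,t_Y)$, constant $(f_X,f_Y)$, residual $a\to b=\neg(a\ast\neg b)$ with $\neg(x,\top)=(\neg x,\top)$ if $x\notin X_{gr}$, $\neg(x,\top)=((\neg x)_\downarrow,\top)$ if $x\in X_{gr}$, $\neg(x,y)=(\neg x,\neg y)$ for $x\in X_{gr},y\in Y$. -}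

module Defs where

open import Level using (Level; suc; _⊔_)
open import Data.Product using (Σ; Σ-syntax; _×_; _,_; proj₁; proj₂)
open import Data.Sum using (_⊎_; inj₁; inj₂)
open import Data.Empty.Polymorphic using (⊥)
open import Relation.Nullary using (¬_)
open import Relation.Binary.PropositionalEquality using (_≡_; _≢_; refl)
open import Algebra.Structures using (IsCommutativeMonoid)
open import Algebra.Lattice.Structures using (IsLattice)
open import Function.Bundles using (_⇔_)

record FLe (ℓ : Level) : Set (suc ℓ) where
  infixr 7 _*_
  infixr 5 _⇒_
  field
    Carrier : Set ℓ
    _∧_ _∨_ _*_ _⇒_ : Carrier → Carrier → Carrier
    t f : Carrier
    isLattice : IsLattice _≡_ _∨_ _∧_
    isCommMonoid : IsCommutativeMonoid _≡_ _*_ t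
  _≤_ : Carrier → Carrier → Set ℓ
  x ≤ y = x ∧ y ≡ x
  field
    residuated : ∀ x y z → ((x * y) ≤ z) ⇔ (y ≤ (x ⇒ z))
  ¬' : Carrier → Carrier
  ¬' x = x ⇒ f

Involutive : ∀ {ℓ} → FLe ℓ → Set ℓ
Involutive X = ∀ x → ¬' (¬' x) ≡ x
  where open FLe X

Odd : ∀ {ℓ} → FLe ℓ → Set ℓ
Odd X = Involutive X × (FLe.t X ≡ FLe.f X)

Invertible : ∀ {ℓ} (X : FLe ℓ) → FLe.Carrier X → Set ℓ
Invertible X x = Σ[ y ∈ Carrier ] (x * y ≡ t)
  where open FLe X

record SubalgebraOfGr {ℓ} (X : FLe ℓ) (H : FLe.Carrier X → Set ℓ) : Set ℓ where
  open FLe X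
  field
    ∧-closed : ∀ {x y} → H x → H y → H (x ∧ y)
    ∨-closed : ∀ {x y} → H x → H y → H (x ∨ y)
    *-closed : ∀ {x y} → H x → H y → H (x * y)
    ⇒-closed : ∀ {x y} → H x → H y → H (x ⇒ y)
    t-closed : H t
    f-closed : H f
    inGr     : ∀ {x} → H x → Invertible X x

-- Operations are given by their graphs (Mul a b c means a∗b = c, Imp a b c
-- means a→b = c).  This lets the partial lexicographic products be defined
-- literally (case distinctions on membership in V or X_gr) without
-- assuming decidability of those memberships.

record RelStr (ℓ : Level) : Set (suc ℓ) where
  field
    Carrier : Set ℓ
    _≤_ : Carrier → Carrier → Set ℓ
    Mul : Carrier → Carrier → Carrier → Set ℓ
    Imp : Carrier → Carrier → Carrier → Set ℓ
    unit fal : Carrier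
  _<_ : Carrier → Carrier → Set ℓ
  x < y = (x ≤ y) × (x ≢ y)
  Neg : Carrier → Carrier → Set ℓ
  Neg x y = Imp x fal y
  Gr : Carrier → Set ℓ
  Gr x = Σ[ y ∈ Carrier ] Mul x y unit

rel : ∀ {ℓ} → FLe ℓ → RelStr ℓ
rel X = record
  { Carrier = Carrier
  ; _≤_ = _≤_
  ; Mul = λ a b c → a * b ≡ c
  ; Imp = λ a b c → (a ⇒ b) ≡ c
  ; unit = t
  ; fal = f
  }
  where open FLe X

module _ {ℓ} (R : RelStr ℓ) where
  open RelStr R

  IsPred : Carrier → Carrier → Set ℓ
  IsPred x p = (p < x) × (∀ z → z < x → z ≤ p)

  IsSucc : Carrier → Carrier → Set ℓ
  IsSucc x s = (x < s) × (∀ z → x < z → s ≤ z)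

  -- d = x_↓ : the largest element smaller than x if it exists, else x
  Down : Carrier → Carrier → Set ℓ
  Down x d = IsPred x d ⊎ ((d ≡ x) × (∀ p → ¬ IsPred x p))

  Up : Carrier → Carrier → Set ℓ
  Up x u = IsSucc x u ⊎ ((u ≡ x) × (∀ s → ¬ IsSucc x s))

  DiscretelyEmbedded : (Carrier → Set ℓ) → Set ℓ
  DiscretelyEmbedded Z = ∀ x → Z x →
    (Σ[ d ∈ Carrier ] (Down x d × (d ≢ x) × Z d)) ×
    (Σ[ u ∈ Carrier ] (Up x u × (u ≢ x) × Z u))

  -- well-definedness of the type II partial lexicographic product with first
  -- factor R (as stated in the context: X_gr discretely embedded into X)
  TypeII-WellDefined : Set ℓ
  TypeII-WellDefined = DiscretelyEmbedded Gr

data Ext₂ {ℓ} (Y : Set ℓ) : Set ℓ where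
  bot : Ext₂ Y
  top : Ext₂ Y
  el  : Y → Ext₂ Y

data Ext₁ {ℓ} (Y : Set ℓ) : Set ℓ where
  top : Ext₁ Y
  el  : Y → Ext₁ Y

module _ {ℓ} (Y : RelStr ℓ) where
  open RelStr Y

  ≤₂ : Ext₂ Carrier → Ext₂ Carrier → Set ℓ
  ≤₂ bot _ = Level.Lift ℓ Data.Unit.⊤
    where import Data.Unit
  ≤₂ top top = Level.Lift ℓ Data.Unit.⊤
    where import Data.Unit
  ≤₂ top _ = ⊥
  ≤₂ (el a) bot = ⊥
  ≤₂ (el a) top = Level.Lift ℓ Data.Unit.⊤
    where import Data.Unit
  ≤₂ (el a) (el b) = a ≤ b

  Mul₂ : Ext₂ Carrier → Ext₂ Carrier → Ext₂ Carrier → Set ℓ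
  Mul₂ bot _ c = c ≡ bot
  Mul₂ top bot c = c ≡ bot
  Mul₂ (el _) bot c = c ≡ bot
  Mul₂ top top c = c ≡ top
  Mul₂ top (el _) c = c ≡ top
  Mul₂ (el _) top c = c ≡ top
  Mul₂ (el a) (el b) (el c) = Mul a b c
  Mul₂ (el a) (el b) _ = ⊥

  Neg₂ : Ext₂ Carrier → Ext₂ Carrier → Set ℓ
  Neg₂ bot c = c ≡ top
  Neg₂ top c = c ≡ bot
  Neg₂ (el a) (el b) = Neg a b
  Neg₂ (el a) _ = ⊥

  ≤₁ : Ext₁ Carrier → Ext₁ Carrier → Set ℓ
  ≤₁ _ top = Level.Lift ℓ Data.Unit.⊤
    where import Data.Unit
  ≤₁ top (el _) = ⊥
  ≤₁ (el a) (el b) = a ≤ b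

  Mul₁ : Ext₁ Carrier → Ext₁ Carrier → Ext₁ Carrier → Set ℓ
  Mul₁ top _ c = c ≡ top
  Mul₁ (el _) top c = c ≡ top
  Mul₁ (el a) (el b) (el c) = Mul a b c
  Mul₁ (el a) (el b) top = ⊥

record TypeICarrier {ℓ} (X Y : RelStr ℓ) (V : RelStr.Carrier X → Set ℓ) : Set ℓ where
  constructor mkI
  field
    fst : RelStr.Carrier X
    snd : Ext₂ (RelStr.Carrier Y)
    .ok : (snd ≡ bot) ⊎ V fst

module _ {ℓ} (X : RelStr ℓ) (V : RelStr.Carrier X → Set ℓ) (Y : RelStr ℓ)
         (Vt : V (RelStr.unit X)) (Vf : V (RelStr.fal X)) where
  private
    module X = RelStr X
    module Y = RelStr Y
    C = TypeICarrier X Y V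
  open TypeICarrier

  NegI : C → C → Set ℓ
  NegI a c = (¬ V (fst a) × X.Neg (fst a) (fst c) × (snd c ≡ bot))
           ⊎ (V (fst a) × X.Neg (fst a) (fst c) × Neg₂ Y (snd a) (snd c))

  MulI : C → C → C → Set ℓ
  MulI a b c = X.Mul (fst a) (fst b) (fst c) × Mul₂ Y (snd a) (snd b) (snd c)

  TypeI : RelStr ℓ
  TypeI = record
    { Carrier = C
    ; _≤_ = λ a b → (fst a X.< fst b) ⊎ ((fst a ≡ fst b) × ≤₂ Y (snd a) (snd b))
    ; Mul = MulI
    ; Imp = λ a b c → Σ[ n ∈ C ] Σ[ m ∈ C ] (NegI b n × MulI a n m × NegI m c)
    ; unit = mkI X.unit (el Y.unit) (inj₂ Vt)
    ; fal = mkI X.fal (el Y.fal) (inj₂ Vf)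
    }

record TypeIICarrier {ℓ} (X Y : RelStr ℓ) : Set ℓ where
  constructor mkII
  field
    fst : RelStr.Carrier X
    snd : Ext₁ (RelStr.Carrier Y)
    .ok : (snd ≡ top) ⊎ RelStr.Gr X fst

module _ {ℓ} (X Y : RelStr ℓ) (gt : RelStr.Gr X (RelStr.unit X))
         (gf : RelStr.Gr X (RelStr.fal X)) where
  private
    module X = RelStr X
    module Y = RelStr Y
    C = TypeIICarrier X Y
  open TypeIICarrier

  NegII' : X.Carrier → Ext₁ Y.Carrier → C → Set ℓ
  NegII' x top c = (snd c ≡ top) ×
    ((¬ X.Gr x × X.Neg x (fst c))
     ⊎ (X.Gr x × Σ[ n ∈ X.Carrier ] (X.Neg x n × Down X n (fst c))))
  NegII' x (el y) c = X.Neg x (fst c) × Σ[ y' ∈ Y.Carrier ] ((snd c ≡ el y') × Y.Neg y y')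

  NegII : C → C → Set ℓ
  NegII a c = NegII' (fst a) (snd a) c

  MulII : C → C → C → Set ℓ
  MulII a b c = X.Mul (fst a) (fst b) (fst c) × Mul₁ Y (snd a) (snd b) (snd c)

  TypeII : RelStr ℓ
  TypeII = record
    { Carrier = C
    ; _≤_ = λ a b → (fst a X.< fst b) ⊎ ((fst a ≡ fst b) × ≤₁ Y (snd a) (snd b))
    ; Mul = MulII
    ; Imp = λ a b c → Σ[ n ∈ C ] Σ[ m ∈ C ] (NegII b n × MulII a n m × NegII m c)
    ; unit = mkII X.unit (el Y.unit) (inj₂ gt)
    ; fal = mkII X.fal (el Y.fal) (inj₂ gf)
    }

record _≅_ {ℓ} (R S : RelStr ℓ) : Set ℓ where
  private
    module R = RelStr R
    module S = RelStr S
  field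
    to   : R.Carrier → S.Carrier
    from : S.Carrier → R.Carrier
    from∘to : ∀ x → from (to x) ≡ x
    to∘from : ∀ y → to (from y) ≡ y
    ≤-iff   : ∀ x y → (x R.≤ y) ⇔ (to x S.≤ to y)
    mul-iff : ∀ x y z → R.Mul x y z ⇔ S.Mul (to x) (to y) (to z)
    imp-iff : ∀ x y z → R.Imp x y z ⇔ S.Imp (to x) (to y) (to z)
    unit-pres : to R.unit ≡ S.unit
    fal-pres  : to R.fal ≡ S.fal

module _ {ℓ} (X : FLe ℓ) where
  open FLe X
  open IsCommutativeMonoid isCommMonoid using (identityˡ)

  gr-t : RelStr.Gr (rel X) t
  gr-t = t , identityˡ t

  ff≡t : Odd X → f * f ≡ t
  ff≡t (_ , t≡f) = Eq.subst (λ u → u * u ≡ t) t≡f (identityˡ t)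
    where import Relation.Binary.PropositionalEquality as Eq

  gr-f : Odd X → RelStr.Gr (rel X) f
  gr-f oX = f , ff≡t oX

module _ {ℓ} (A L : FLe ℓ) (H : FLe.Carrier A → Set ℓ) (sub : SubalgebraOfGr A H) where
  open SubalgebraOfGr sub

  C[A,H,L] : RelStr ℓ
  C[A,H,L] = TypeI (rel A) H (rel L) t-closed f-closed

  gr-tC : RelStr.Gr C[A,H,L] (RelStr.unit C[A,H,L])
  gr-tC = RelStr.unit C[A,H,L] , proj₂ (gr-t A) , proj₂ (gr-t L)

  gr-fC : Odd A → Odd L → RelStr.Gr C[A,H,L] (RelStr.fal C[A,H,L])
  gr-fC oA oL = RelStr.fal C[A,H,L] , ff≡t A oA , ff≡t L oL

-- The type II product of C = A ×_H L with B and the type I product of A, H and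
-- M = L ×_II B are carried by the same triples, (a, ⊥), (a, ⊤) and (a, l, s) with
-- a ∈ H, l ∈ L, s ∈ B ∪ {⊤} and s = ⊤ unless l ∈ L_gr; regrouping ((a, l), s) as
-- (a, (l, s)) is the isomorphism. Since H ≤ A_gr, the group part of C is H × L_gr,
-- and the predecessor of (a, l) in C is (a, l↓) whenever l has a predecessor in L.
-- Hence C_gr is discretely embedded into C iff L_gr is into L, and the shifted
-- negation ¬(c, ⊤) = ((¬c)↓, ⊤) of the outer type II product matches the one of M
-- inside the second coordinate. Order and product are lexicographic resp.
-- coordinatewise on both sides, and implication is ¬(x ∗ ¬y) on both sides.
module Submission where

open import Defs
open import Data.Product using (_×_; Σ; Σ-syntax; _,_; proj₁; proj₂)
open import Function.Bundles using (_⇔_; Equivalence; mk⇔)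
open import Level using (lift)
open import Data.Sum using (_⊎_; inj₁; inj₂)
import Data.Empty as Empty
open import Data.Empty.Irrelevant using (⊥-elim)
open import Relation.Nullary using (¬_)
open import Relation.Binary.PropositionalEquality
open import Algebra.Structures using (IsCommutativeMonoid)
open import Algebra.Lattice.Structures using (IsLattice)
open import Function.Base using (case_of_)
open import Function.Properties.Equivalence using () renaming (sym to ⇔-sym; trans to ⇔-trans)

module FLeProperties {ℓ} (X : FLe ℓ) where
  open FLe X
  open IsLattice isLattice using (∧-comm; ∧-assoc; ∨-absorbs-∧; ∧-absorbs-∨)
  open IsCommutativeMonoid isCommMonoid using (assoc; identityˡ; comm)

  ≤-refl : ∀ x → x ≤ x
  ≤-refl x = trans (cong (x ∧_) (sym (∨-absorbs-∧ x x))) (∧-absorbs-∨ x (x ∧ x))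

  ≤-reflexive : ∀ {x y} → x ≡ y → x ≤ y
  ≤-reflexive {x} refl = ≤-refl x

  ≤-trans : ∀ {x y z} → x ≤ y → y ≤ z → x ≤ z
  ≤-trans {x} {y} {z} x≤y y≤z =
    trans (cong (_∧ z) (sym x≤y)) (trans (∧-assoc x y z) (trans (cong (x ∧_) y≤z) x≤y))

  ≤-antisym : ∀ {x y} → x ≤ y → y ≤ x → x ≡ y
  ≤-antisym {x} {y} x≤y y≤x = trans (sym x≤y) (trans (∧-comm x y) y≤x)

  *-monoʳ-≤ : ∀ {x y} z → x ≤ y → (z * x) ≤ (z * y)
  *-monoʳ-≤ {x} {y} z x≤y = Equivalence.from (residuated z x (z * y))
    (≤-trans x≤y (Equivalence.to (residuated z y (z * y)) (≤-refl _)))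

  cancel-inverse : ∀ {g k} → g * k ≡ t → ∀ z → k * (g * z) ≡ z
  cancel-inverse {g} {k} gk≡t z = begin
    k * (g * z) ≡⟨ sym (assoc k g z) ⟩
    (k * g) * z ≡⟨ cong (_* z) (trans (comm k g) gk≡t) ⟩
    t * z       ≡⟨ identityˡ z ⟩
    z           ∎
    where open ≡-Reasoning

  ⇒-by-inverse : ∀ {g k} → g * k ≡ t → ∀ z → (g ⇒ z) ≡ k * z
  ⇒-by-inverse {g} {k} gk≡t z = ≤-antisym ⇒≤ ≤⇒
    where
    ⇒≤ : (g ⇒ z) ≤ (k * z)
    ⇒≤ = subst (_≤ (k * z)) (cancel-inverse gk≡t (g ⇒ z))
           (*-monoʳ-≤ k (Equivalence.from (residuated g (g ⇒ z) z) (≤-refl _)))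
    ≤⇒ : (k * z) ≤ (g ⇒ z)
    ≤⇒ = Equivalence.to (residuated g (k * z) z)
           (≤-reflexive (cancel-inverse (trans (comm k g) gk≡t) z))

  module _ (oX : Odd X) where
    private
      t≡f = proj₂ oX

    ¬-inverse : ∀ {g k} → g * k ≡ t → ¬' g ≡ k
    ¬-inverse {g} {k} gk≡t = begin
      g ⇒ f ≡⟨ ⇒-by-inverse gk≡t f ⟩
      k * f ≡⟨ cong (k *_) (sym t≡f) ⟩
      k * t ≡⟨ IsCommutativeMonoid.identityʳ isCommMonoid k ⟩
      k     ∎
      where open ≡-Reasoning

    ¬f≡t : ¬' f ≡ t
    ¬f≡t = trans (¬-inverse (ff≡t X oX)) (sym t≡f)

    *-inverseˡ-¬ : ∀ {g k} → g * k ≡ t → ¬' g * g ≡ t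
    *-inverseˡ-¬ {g} {k} gk≡t = trans (cong (_* g) (¬-inverse gk≡t)) (trans (comm k g) gk≡t)

    Gr-¬ : ∀ {x} → RelStr.Gr (rel X) x → RelStr.Gr (rel X) (¬' x)
    Gr-¬ {x} (_ , x*y≡t) = x , *-inverseˡ-¬ x*y≡t

module _ {ℓ} (R : RelStr ℓ) where
  open RelStr R

  Down≢⇒IsPred : ∀ {x d} → Down R x d → d ≢ x → IsPred R x d
  Down≢⇒IsPred (inj₁ d-pred) _ = d-pred
  Down≢⇒IsPred (inj₂ (d≡x , _)) d≢x = Empty.⊥-elim (d≢x d≡x)

  Up≢⇒IsSucc : ∀ {x u} → Up R x u → u ≢ x → IsSucc R x u
  Up≢⇒IsSucc (inj₁ u-succ) _ = u-succ
  Up≢⇒IsSucc (inj₂ (u≡x , _)) u≢x = Empty.⊥-elim (u≢x u≡x)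

  module _ (≤-antisym : ∀ {x y} → x ≤ y → y ≤ x → x ≡ y) where

    IsPred-unique : ∀ {x d e} → IsPred R x d → IsPred R x e → d ≡ e
    IsPred-unique (d<x , d-max) (e<x , e-max) = ≤-antisym (e-max _ d<x) (d-max _ e<x)

    Down-of-IsPred : ∀ {x p d} → IsPred R x p → Down R x d → d ≡ p
    Down-of-IsPred p-pred (inj₁ d-pred) = IsPred-unique d-pred p-pred
    Down-of-IsPred p-pred (inj₂ (_ , no-pred)) = Empty.⊥-elim (no-pred _ p-pred)

Residual : ∀ {ℓ} {Carrier : Set ℓ} → (Carrier → Carrier → Set ℓ)
         → (Carrier → Carrier → Carrier → Set ℓ) → Carrier → Carrier → Carrier → Set ℓ
Residual Neg Mul a b c = Σ[ n ∈ _ ] Σ[ m ∈ _ ] (Neg b n × Mul a n m × Neg m c)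

module _ {ℓ} {Carrier : Set ℓ} {Neg : Carrier → Carrier → Set ℓ}
         {Mul : Carrier → Carrier → Carrier → Set ℓ} {u f : Carrier} where

  Residual-f⇔Neg : (∀ {n} → Neg f n → n ≡ u) → Neg f u
                 → (∀ {c m} → Mul c u m → m ≡ c) → (∀ c → Mul c u c)
                 → ∀ c d → Residual Neg Mul c f d ⇔ Neg c d
  Residual-f⇔Neg ¬f-unique ¬f≡u u-unitʳ u-identityʳ c d = mk⇔
    (λ (n , m , ¬f≡n , c*n≡m , ¬m≡d) →
       subst (λ m → Neg m d) (u-unitʳ (subst (λ n → Mul c n m) (¬f-unique ¬f≡n) c*n≡m)) ¬m≡d)
    (λ ¬c≡d → u , c , ¬f≡u , u-identityʳ c , ¬c≡d)

module _ {ℓ} {P Q : Set ℓ} {NegP : P → P → Set ℓ} {MulP : P → P → P → Set ℓ}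
         {NegQ : Q → Q → Set ℓ} {MulQ : Q → Q → Q → Set ℓ}
         (to : P → Q) (from : Q → P) (to∘from : ∀ y → to (from y) ≡ y) where

  Residual-transport : (∀ x y → NegP x y ⇔ NegQ (to x) (to y))
                     → (∀ x y z → MulP x y z ⇔ MulQ (to x) (to y) (to z))
                     → ∀ x y z → Residual NegP MulP x y z ⇔ Residual NegQ MulQ (to x) (to y) (to z)
  Residual-transport Neg-iff Mul-iff x y z = mk⇔
    (λ (n , m , ¬y≡n , x*n≡m , ¬m≡z) →
       to n , to m , Equivalence.to (Neg-iff y n) ¬y≡n ,
       Equivalence.to (Mul-iff x n m) x*n≡m , Equivalence.to (Neg-iff m z) ¬m≡z)
    (λ (n , m , ¬y≡n , x*n≡m , ¬m≡z) →
       from n , from m ,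
       Equivalence.from (Neg-iff y (from n)) (subst (NegQ (to y)) (sym (to∘from n)) ¬y≡n) ,
       Equivalence.from (Mul-iff x (from n) (from m))
         (subst₂ (MulQ (to x)) (sym (to∘from n)) (sym (to∘from m)) x*n≡m) ,
       Equivalence.from (Neg-iff (from m) z) (subst (λ m → NegQ m (to z)) (sym (to∘from m)) ¬m≡z))

module TypeIProduct {ℓ} (X Y : FLe ℓ) (V : FLe.Carrier X → Set ℓ)
                    (sub : SubalgebraOfGr X V) where
  open SubalgebraOfGr sub
  open TypeICarrier
  private
    module X = FLe X
    module Y = FLe Y
    module PX = FLeProperties X
    module PY = FLeProperties Y
    module RX = RelStr (rel X)
    module RY = RelStr (rel Y)

  C : RelStr ℓ
  C = C[A,H,L] X Y V sub
  module C = RelStr C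

  mkI-≡ : ∀ {a a' e e'} .{p p'} → a ≡ a' → e ≡ e' → _≡_ {A = C.Carrier} (mkI a e p) (mkI a' e' p')
  mkI-≡ refl refl = refl

  el-injective : ∀ {y y' : Y.Carrier} → _≡_ {A = Ext₂ Y.Carrier} (el y) (el y') → y ≡ y'
  el-injective refl = refl

  V-of-≢bot : ∀ {a} {E : Set ℓ} {e : Ext₂ E} → (e ≡ bot ⊎ V a) → e ≢ bot → V a
  V-of-≢bot (inj₁ e≡bot) e≢bot = Empty.⊥-elim (e≢bot e≡bot)
  V-of-≢bot (inj₂ v) _ = v

  V-of-el : ∀ {a} {E : Set ℓ} {y : E} → (el y ≡ bot ⊎ V a) → V a
  V-of-el p = V-of-≢bot p λ ()

  V-of-top : ∀ {a} {E : Set ℓ} → (_≡_ {A = Ext₂ E} top bot ⊎ V a) → V a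
  V-of-top p = V-of-≢bot p λ ()

  ≤-fst : ∀ c d → c C.≤ d → fst c X.≤ fst d
  ≤-fst _ _ (inj₁ (a≤a' , _)) = a≤a'
  ≤-fst _ _ (inj₂ (refl , _)) = PX.≤-refl _

  ≤-snd : ∀ {a e e'} .{p q} → mkI a e p C.≤ mkI a e' q → ≤₂ (rel Y) e e'
  ≤-snd (inj₁ (_ , a≢a)) = Empty.⊥-elim (a≢a refl)
  ≤-snd (inj₂ (_ , e≤e')) = e≤e'

  ≤₂-antisym : ∀ {e e'} → ≤₂ (rel Y) e e' → ≤₂ (rel Y) e' e → e ≡ e'
  ≤₂-antisym {bot} {bot} _ _ = refl
  ≤₂-antisym {top} {top} _ _ = refl
  ≤₂-antisym {el y} {el y'} y≤y' y'≤y = cong el (PY.≤-antisym y≤y' y'≤y)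
  ≤₂-antisym {bot} {top} _ ()
  ≤₂-antisym {bot} {el _} _ ()
  ≤₂-antisym {top} {bot} ()
  ≤₂-antisym {el _} {bot} ()
  ≤₂-antisym {top} {el _} ()
  ≤₂-antisym {el _} {top} _ ()

  ≤-antisym : ∀ {c d} → c C.≤ d → d C.≤ c → c ≡ d
  ≤-antisym {c} {d} (inj₁ (a≤a' , a≢a')) d≤c =
    Empty.⊥-elim (a≢a' (PX.≤-antisym a≤a' (≤-fst d c d≤c)))
  ≤-antisym {mkI a e p} {mkI _ e' q} (inj₂ (refl , e≤e')) d≤c =
    mkI-≡ refl (≤₂-antisym {e} {e'} e≤e' (≤-snd {a} {e'} {e} {q} {p} d≤c))

  el<el : ∀ {a w x} .{p q} → w RY.< x → mkI a (el w) p C.< mkI a (el x) q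
  el<el (w≤x , w≢x) = inj₂ (refl , w≤x) , λ eq → w≢x (el-injective (cong snd eq))

  el<el⁻¹ : ∀ {a w x} .{p q} → mkI a (el w) p C.< mkI a (el x) q → w RY.< x
  el<el⁻¹ {a} {w} {x} {p} {q} (c≤d , c≢d) =
    ≤-snd {a} {el w} {el x} {p} {q} c≤d , λ w≡x → c≢d (mkI-≡ refl (cong el w≡x))

  bot<el : ∀ {a x} .{p q} → mkI a bot p C.< mkI a (el x) q
  bot<el = inj₂ (refl , lift _) , λ ()

  el<top : ∀ {a x} .{p q} → mkI a (el x) p C.< mkI a top q
  el<top = inj₂ (refl , lift _) , λ ()

  IsPred-el⇐ : ∀ {a x k} .{p q} → IsPred (rel Y) x k → IsPred C (mkI a (el x) p) (mkI a (el k) q)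
  IsPred-el⇐ {a} {x} {k} {p} {q} (k<x , k-max) = el<el k<x , below-k
    where
    below-k : ∀ z → z C.< mkI a (el x) p → z C.≤ mkI a (el k) q
    below-k z (inj₁ a'<a , _) = inj₁ a'<a
    below-k (mkI _ bot _) (inj₂ (refl , _) , _) = inj₂ (refl , lift _)
    below-k (mkI _ top _) (inj₂ (refl , lift ()) , _)
    below-k (mkI _ (el w) _) w<x@(inj₂ (refl , _) , _) = inj₂ (refl , k-max w (el<el⁻¹ w<x))

  IsSucc-el⇐ : ∀ {a x k} .{p q} → IsSucc (rel Y) x k → IsSucc C (mkI a (el x) p) (mkI a (el k) q)
  IsSucc-el⇐ {a} {x} {k} {p} {q} (x<k , k-min) = el<el x<k , above-k
    where
    above-k : ∀ z → mkI a (el x) p C.< z → mkI a (el k) q C.≤ z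
    above-k z (inj₁ a<a' , _) = inj₁ a<a'
    above-k (mkI _ bot _) (inj₂ (refl , lift ()) , _)
    above-k (mkI _ top _) (inj₂ (refl , _) , _) = inj₂ (refl , lift _)
    above-k (mkI _ (el w) _) x<w@(inj₂ (refl , _) , _) = inj₂ (refl , k-min w (el<el⁻¹ x<w))

  IsPred-el⇒ : ∀ {a a' x k} .{p q} → IsPred C (mkI a (el x) p) (mkI a' (el k) q)
             → (a' ≡ a) × IsPred (rel Y) x k
  IsPred-el⇒ {a} {a'} {x} {k} {p} {q} (d<c , d-max)
    with PX.≤-antisym (≤-fst (mkI a' (el k) q) (mkI a (el x) p) (proj₁ d<c))
                      (≤-fst (mkI a bot (inj₁ refl)) (mkI a' (el k) q) (d-max (mkI a bot (inj₁ refl)) bot<el))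
  ... | refl = refl , el<el⁻¹ d<c , λ w w<x →
    ≤-snd {a} {el w} {el k} {inj₂ (V-of-el p)} {q} (d-max (mkI a (el w) (inj₂ (V-of-el p))) (el<el w<x))

  IsSucc-el⇒ : ∀ {a a' x k} .{p q} → IsSucc C (mkI a (el x) p) (mkI a' (el k) q)
             → (a' ≡ a) × IsSucc (rel Y) x k
  IsSucc-el⇒ {a} {a'} {x} {k} {p} {q} (c<d , d-min)
    with PX.≤-antisym (≤-fst (mkI a' (el k) q) (mkI a top (inj₂ (V-of-el p)))
                             (d-min (mkI a top (inj₂ (V-of-el p))) el<top))
                      (≤-fst (mkI a (el x) p) (mkI a' (el k) q) (proj₁ c<d))
  ... | refl = refl , el<el⁻¹ c<d , λ w x<w →
    ≤-snd {a} {el k} {el w} {q} {inj₂ (V-of-el p)} (d-min (mkI a (el w) (inj₂ (V-of-el p))) (el<el x<w))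

  ¬Gr-bot : ∀ a .p → ¬ C.Gr (mkI a bot p)
  ¬Gr-bot _ _ (mkI _ _ _ , _ , ())

  ¬Gr-top : ∀ a .p → ¬ C.Gr (mkI a top p)
  ¬Gr-top _ _ (mkI _ bot _ , _ , ())
  ¬Gr-top _ _ (mkI _ top _ , _ , ())
  ¬Gr-top _ _ (mkI _ (el _) _ , _ , ())

  Gr-fst : ∀ c → C.Gr c → RX.Gr (fst c)
  Gr-fst _ (c' , a*a'≡t , _) = fst c' , a*a'≡t

  Gr-snd : ∀ a y .p → C.Gr (mkI a (el y) p) → RY.Gr y
  Gr-snd _ _ _ (mkI _ (el y') _ , _ , y*y'≡t) = y' , y*y'≡t
  Gr-snd _ _ _ (mkI _ bot _ , _ , ())
  Gr-snd _ _ _ (mkI _ top _ , _ , ())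

  Gr-intro : Odd X → ∀ a y .p → RX.Gr a → RY.Gr y → C.Gr (mkI a (el y) p)
  Gr-intro oX a _ p (_ , a*a'≡t) (y' , y*y'≡t) =
    mkI (X.¬' a) (el y') (inj₂ (⇒-closed (V-of-el p) f-closed)) ,
    trans (cong (a X.*_) (PX.¬-inverse oX a*a'≡t)) a*a'≡t , y*y'≡t

  IsPred-el-Gr : ∀ a y .p d → IsPred C (mkI a (el y) p) d → C.Gr d
               → Σ[ k ∈ Y.Carrier ] (IsPred (rel Y) y k × RY.Gr k)
  IsPred-el-Gr _ _ _ (mkI a' bot r) _ gd = Empty.⊥-elim (¬Gr-bot a' r gd)
  IsPred-el-Gr _ _ _ (mkI a' top r) _ gd = Empty.⊥-elim (¬Gr-top a' r gd)
  IsPred-el-Gr _ _ _ (mkI a' (el k) r) d-pred gd =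
    k , proj₂ (IsPred-el⇒ d-pred) , Gr-snd a' k r gd

  IsSucc-el-Gr : ∀ a y .p d → IsSucc C (mkI a (el y) p) d → C.Gr d
               → Σ[ k ∈ Y.Carrier ] (IsSucc (rel Y) y k × RY.Gr k)
  IsSucc-el-Gr _ _ _ (mkI a' bot r) _ gd = Empty.⊥-elim (¬Gr-bot a' r gd)
  IsSucc-el-Gr _ _ _ (mkI a' top r) _ gd = Empty.⊥-elim (¬Gr-top a' r gd)
  IsSucc-el-Gr _ _ _ (mkI a' (el k) r) d-succ gd =
    k , proj₂ (IsSucc-el⇒ d-succ) , Gr-snd a' k r gd

  TypeII-WellDefined⇔ : Odd X → TypeII-WellDefined C ⇔ TypeII-WellDefined (rel Y)
  TypeII-WellDefined⇔ oX = mk⇔ from-C to-C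
    where
    from-C : TypeII-WellDefined C → TypeII-WellDefined (rel Y)
    from-C wdC y gy with wdC (mkI X.t (el y) (inj₂ t-closed)) (Gr-intro oX X.t y (inj₂ t-closed) (gr-t X) gy)
    ... | (d , d↓ , d≢c , gd) , (u , u↑ , u≢c , gu)
      with IsPred-el-Gr X.t y _ d (Down≢⇒IsPred C d↓ d≢c) gd
         | IsSucc-el-Gr X.t y _ u (Up≢⇒IsSucc C u↑ u≢c) gu
    ... | k , k-pred , gk | m , m-succ , gm =
      (k , inj₁ k-pred , proj₂ (proj₁ k-pred) , gk) ,
      (m , inj₁ m-succ , ≢-sym (proj₂ (proj₁ m-succ)) , gm)

    to-C : TypeII-WellDefined (rel Y) → TypeII-WellDefined C
    to-C wdY (mkI a bot p) g = Empty.⊥-elim (¬Gr-bot a p g)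
    to-C wdY (mkI a top p) g = Empty.⊥-elim (¬Gr-top a p g)
    to-C wdY (mkI a (el y) p) g with wdY y (Gr-snd a y p g)
    ... | (k , k↓ , k≢y , gk) , (m , m↑ , m≢y , gm) =
      (d , inj₁ d-pred , proj₂ (proj₁ d-pred) , Gr-intro oX a k (inj₂ (V-of-el p)) ga gk) ,
      (u , inj₁ u-succ , ≢-sym (proj₂ (proj₁ u-succ)) , Gr-intro oX a m (inj₂ (V-of-el p)) ga gm)
      where
      ga = Gr-fst (mkI a (el y) p) g
      d u : C.Carrier
      d = mkI a (el k) (inj₂ (V-of-el p))
      u = mkI a (el m) (inj₂ (V-of-el p))
      d-pred : IsPred C (mkI a (el y) p) d
      d-pred = IsPred-el⇐ (Down≢⇒IsPred (rel Y) k↓ k≢y)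
      u-succ : IsSucc C (mkI a (el y) p) u
      u-succ = IsSucc-el⇐ (Up≢⇒IsSucc (rel Y) m↑ m≢y)

  module _ (wdY : TypeII-WellDefined (rel Y)) where

    pred-of-Gr : ∀ {y} → RY.Gr y → Σ[ k ∈ Y.Carrier ] IsPred (rel Y) y k
    pred-of-Gr {y} gy with wdY y gy
    ... | (k , k↓ , k≢y , _) , _ = k , Down≢⇒IsPred (rel Y) k↓ k≢y

    Down-Gr⇒IsPred : ∀ {y k} → RY.Gr y → Down (rel Y) y k → IsPred (rel Y) y k
    Down-Gr⇒IsPred _ (inj₁ k-pred) = k-pred
    Down-Gr⇒IsPred gy (inj₂ (_ , no-pred)) = Empty.⊥-elim (no-pred _ (proj₂ (pred-of-Gr gy)))

    Down-el⇐ : ∀ {a y k} .{p q} → RY.Gr y → Down (rel Y) y k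
             → Down C (mkI a (el y) p) (mkI a (el k) q)
    Down-el⇐ gy y↓ = inj₁ (IsPred-el⇐ (Down-Gr⇒IsPred gy y↓))

    Down-el⇒ : ∀ {a y} .{p} d → RY.Gr y → Down C (mkI a (el y) p) d
             → (fst d ≡ a) × Σ[ k ∈ Y.Carrier ] (snd d ≡ el k × Down (rel Y) y k)
    Down-el⇒ {a} {p = p} d gy d↓ =
      cong fst d≡ , k , cong snd d≡ , inj₁ k-pred
      where
      k = proj₁ (pred-of-Gr gy)
      k-pred = proj₂ (pred-of-Gr gy)
      d≡ : d ≡ mkI a (el k) (inj₂ (V-of-el p))
      d≡ = Down-of-IsPred C ≤-antisym (IsPred-el⇐ k-pred) d↓

  NegC : C.Carrier → C.Carrier → Set ℓ
  NegC = NegI (rel X) V (rel Y) t-closed f-closed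

  MulC : C.Carrier → C.Carrier → C.Carrier → Set ℓ
  MulC = MulI (rel X) V (rel Y) t-closed f-closed

  Mul₂-identityʳ : ∀ e → Mul₂ (rel Y) e (el Y.t) e
  Mul₂-identityʳ bot = refl
  Mul₂-identityʳ top = refl
  Mul₂-identityʳ (el y) = IsCommutativeMonoid.identityʳ Y.isCommMonoid y

  Mul₂-unitʳ : ∀ e e' → Mul₂ (rel Y) e (el Y.t) e' → e' ≡ e
  Mul₂-unitʳ bot _ e'≡bot = e'≡bot
  Mul₂-unitʳ top _ e'≡top = e'≡top
  Mul₂-unitʳ (el y) (el y') y*t≡y' =
    cong el (trans (sym y*t≡y') (IsCommutativeMonoid.identityʳ Y.isCommMonoid y))
  Mul₂-unitʳ (el _) bot ()
  Mul₂-unitʳ (el _) top ()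

  Neg⇔NegI : Odd X → Odd Y → ∀ c d → C.Neg c d ⇔ NegC c d
  Neg⇔NegI oX oY = Residual-f⇔Neg {Neg = NegC} {Mul = MulC} {C.unit} {C.fal}
    ¬f-unique (inj₂ (f-closed , PX.¬f≡t oX , PY.¬f≡t oY))
    unitʳ (λ c → IsCommutativeMonoid.identityʳ X.isCommMonoid (fst c) , Mul₂-identityʳ (snd c))
    where
    ¬f-unique : ∀ {n} → NegC C.fal n → n ≡ C.unit
    ¬f-unique (inj₁ (¬Vf , _)) = Empty.⊥-elim (¬Vf f-closed)
    ¬f-unique {mkI _ (el _) _} (inj₂ (_ , ¬f≡n₁ , ¬f≡n₂)) =
      mkI-≡ (trans (sym ¬f≡n₁) (PX.¬f≡t oX)) (cong el (trans (sym ¬f≡n₂) (PY.¬f≡t oY)))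
    ¬f-unique {mkI _ bot _} (inj₂ (_ , _ , ()))
    ¬f-unique {mkI _ top _} (inj₂ (_ , _ , ()))

    unitʳ : ∀ {c m} → MulC c C.unit m → m ≡ c
    unitʳ {mkI c₁ c₂ _} {mkI m₁ m₂ _} (c₁*t≡m₁ , c₂*t≡m₂) =
      mkI-≡ (trans (sym c₁*t≡m₁) (IsCommutativeMonoid.identityʳ X.isCommMonoid c₁))
            (Mul₂-unitʳ c₂ m₂ c₂*t≡m₂)

module TypeIIProduct {ℓ} (X Y : FLe ℓ) (oX : Odd X) where
  open TypeIICarrier
  private
    module X = FLe X
    module Y = FLe Y
    module PX = FLeProperties X
    module PY = FLeProperties Y

  M : RelStr ℓ
  M = TypeII (rel X) (rel Y) (gr-t X) (gr-f X oX)
  module M = RelStr M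

  NegM : M.Carrier → M.Carrier → Set ℓ
  NegM = NegII (rel X) (rel Y) (gr-t X) (gr-f X oX)

  MulM : M.Carrier → M.Carrier → M.Carrier → Set ℓ
  MulM = MulII (rel X) (rel Y) (gr-t X) (gr-f X oX)

  mkII-≡ : ∀ {a a' s s'} .{p p'} → a ≡ a' → s ≡ s' → _≡_ {A = M.Carrier} (mkII a s p) (mkII a' s' p')
  mkII-≡ refl refl = refl

  Mul₁-identityʳ : ∀ s → Mul₁ (rel Y) s (el Y.t) s
  Mul₁-identityʳ top = refl
  Mul₁-identityʳ (el y) = IsCommutativeMonoid.identityʳ Y.isCommMonoid y

  Mul₁-unitʳ : ∀ s s' → Mul₁ (rel Y) s (el Y.t) s' → s' ≡ s
  Mul₁-unitʳ top _ s'≡top = s'≡top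
  Mul₁-unitʳ (el y) (el y') y*t≡y' =
    cong el (trans (sym y*t≡y') (IsCommutativeMonoid.identityʳ Y.isCommMonoid y))
  Mul₁-unitʳ (el _) top ()

  Neg⇔NegII : Odd Y → ∀ c d → M.Neg c d ⇔ NegM c d
  Neg⇔NegII oY = Residual-f⇔Neg {Neg = NegM} {Mul = MulM} {M.unit} {M.fal} ¬f-unique
    (PX.¬f≡t oX , Y.t , refl , PY.¬f≡t oY)
    unitʳ (λ c → IsCommutativeMonoid.identityʳ X.isCommMonoid (fst c) , Mul₁-identityʳ (snd c))
    where
    ¬f-unique : ∀ {n} → NegM M.fal n → n ≡ M.unit
    ¬f-unique {mkII _ _ _} (¬f≡n₁ , _ , n₂≡el , ¬f≡n₂) =
      mkII-≡ (trans (sym ¬f≡n₁) (PX.¬f≡t oX))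
             (trans n₂≡el (cong el (trans (sym ¬f≡n₂) (PY.¬f≡t oY))))

    unitʳ : ∀ {c m} → MulM c M.unit m → m ≡ c
    unitʳ {mkII c₁ c₂ _} {mkII m₁ m₂ _} (c₁*t≡m₁ , c₂*t≡m₂) =
      mkII-≡ (trans (sym c₁*t≡m₁) (IsCommutativeMonoid.identityʳ X.isCommMonoid c₁))
             (Mul₁-unitʳ c₂ m₂ c₂*t≡m₂)

module Isomorphism {ℓ} (A L B : FLe ℓ) (H : FLe.Carrier A → Set ℓ)
                   (oA : Odd A) (oL : Odd L) (oB : Odd B) (sub : SubalgebraOfGr A H) where
  open SubalgebraOfGr sub
  open TypeIProduct A L H sub
  open TypeIIProduct L B oL
  open Equivalence
  private
    module L = FLe L
    module B = FLe B
    module RL = RelStr (rel L)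
    module PL = FLeProperties L
    module RA = RelStr (rel A)
    module RB = RelStr (rel B)

  P : RelStr ℓ
  P = TypeII C (rel B) (gr-tC A L H sub) (gr-fC A L H sub oA oL)
  module P = RelStr P

  Q : RelStr ℓ
  Q = TypeI (rel A) H M t-closed f-closed
  module Q = RelStr Q

  Gr-C⇒Gr-L : ∀ a l .p {s : Ext₁ B.Carrier}
            → (s ≡ top ⊎ C.Gr (mkI a (el l) p)) → (s ≡ top ⊎ RL.Gr l)
  Gr-C⇒Gr-L _ _ _ (inj₁ s≡top) = inj₁ s≡top
  Gr-C⇒Gr-L a l p (inj₂ g) = inj₂ (Gr-snd a l p g)

  Gr-L⇒Gr-C : ∀ a l (h : H a) {s : Ext₁ B.Carrier}
            → (s ≡ top ⊎ RL.Gr l) → (s ≡ top ⊎ C.Gr (mkI a (el l) (inj₂ h)))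
  Gr-L⇒Gr-C _ _ _ (inj₁ s≡top) = inj₁ s≡top
  Gr-L⇒Gr-C a l h (inj₂ g) = inj₂ (Gr-intro oA a l (inj₂ h) (inGr h) g)

  -- the elements (a, ⊥, b) and (a, ⊤, b) with b ∈ B do not exist in P
  no-el-over-bot : ∀ a .p b → ¬ (_≡_ {A = Ext₁ B.Carrier} (el b) top ⊎ C.Gr (mkI a bot p))
  no-el-over-bot a p b (inj₁ ())
  no-el-over-bot a p b (inj₂ g) = ¬Gr-bot a p g

  no-el-over-top : ∀ a .p b → ¬ (_≡_ {A = Ext₁ B.Carrier} (el b) top ⊎ C.Gr (mkI a top p))
  no-el-over-top a p b (inj₁ ())
  no-el-over-top a p b (inj₂ g) = ¬Gr-top a p g

  τ : ∀ a (e : Ext₂ L.Carrier) .p (s : Ext₁ B.Carrier) .(q : s ≡ top ⊎ C.Gr (mkI a e p))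
    → Ext₂ M.Carrier
  τ a bot p s q = bot
  τ a top p s q = top
  τ a (el l) p s q = el (mkII l s (Gr-C⇒Gr-L a l p q))

  τ-ok : ∀ a (e : Ext₂ L.Carrier) (p : e ≡ bot ⊎ H a) (s : Ext₁ B.Carrier)
         .(q : s ≡ top ⊎ C.Gr (mkI a e p)) → τ a e p s q ≡ bot ⊎ H a
  τ-ok a bot p s q = inj₁ refl
  τ-ok a top p s q = inj₂ (V-of-top p)
  τ-ok a (el l) p s q = inj₂ (V-of-el p)

  toQ : P.Carrier → Q.Carrier
  toQ (mkII (mkI a e p) s q) = mkI a (τ a e p s q) (τ-ok a e p s q)

  fromQ : Q.Carrier → P.Carrier
  fromQ (mkI a bot p) = mkII (mkI a bot (inj₁ refl)) top (inj₁ refl)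
  fromQ (mkI a top p) = mkII (mkI a top (inj₂ (V-of-top p))) top (inj₁ refl)
  fromQ (mkI a (el (mkII l s q)) p) =
    mkII (mkI a (el l) (inj₂ (V-of-el p))) s (Gr-L⇒Gr-C a l (V-of-el p) q)

  fromQ∘toQ : ∀ x → fromQ (toQ x) ≡ x
  fromQ∘toQ (mkII (mkI a bot p) top q) = refl
  fromQ∘toQ (mkII (mkI a bot p) (el b) q) = ⊥-elim (no-el-over-bot a p b q)
  fromQ∘toQ (mkII (mkI a top p) top q) = refl
  fromQ∘toQ (mkII (mkI a top p) (el b) q) = ⊥-elim (no-el-over-top a p b q)
  fromQ∘toQ (mkII (mkI a (el l) p) s q) = refl

  toQ∘fromQ : ∀ y → toQ (fromQ y) ≡ y
  toQ∘fromQ (mkI a bot p) = refl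
  toQ∘fromQ (mkI a top p) = refl
  toQ∘fromQ (mkI a (el (mkII l s q)) p) = refl

  toQ-mono-≤ : ∀ x y → x P.≤ y → toQ x Q.≤ toQ y
  toQ-mono-≤ (mkII (mkI _ _ _) _ _) (mkII (mkI _ _ _) _ _) (inj₁ (inj₁ a<a' , _)) = inj₁ a<a'
  toQ-mono-≤ (mkII (mkI a bot p) s q) (mkII (mkI _ e' p') s' q') (inj₁ (inj₂ (refl , _) , _)) =
    inj₂ (refl , lift _)
  toQ-mono-≤ (mkII (mkI a top p) s q) (mkII (mkI _ bot p') s' q') (inj₁ (inj₂ (refl , lift ()) , _))
  toQ-mono-≤ (mkII (mkI a top p) s q) (mkII (mkI _ top p') s' q') (inj₁ (inj₂ (refl , _) , c≢c)) =
    Empty.⊥-elim (c≢c refl)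
  toQ-mono-≤ (mkII (mkI a top p) s q) (mkII (mkI _ (el _) p') s' q') (inj₁ (inj₂ (refl , lift ()) , _))
  toQ-mono-≤ (mkII (mkI a (el l) p) s q) (mkII (mkI _ bot p') s' q') (inj₁ (inj₂ (refl , lift ()) , _))
  toQ-mono-≤ (mkII (mkI a (el l) p) s q) (mkII (mkI _ top p') s' q') (inj₁ (inj₂ (refl , _) , _)) =
    inj₂ (refl , lift _)
  toQ-mono-≤ (mkII (mkI a (el l) p) s q) (mkII (mkI _ (el l') p') s' q') (inj₁ (inj₂ (refl , l≤l') , c≢c')) =
    inj₂ (refl , inj₁ (l≤l' , λ l≡l' → c≢c' (mkI-≡ refl (cong el l≡l'))))
  toQ-mono-≤ (mkII (mkI a bot p) s q) (mkII _ s' q') (inj₂ (refl , _)) = inj₂ (refl , lift _)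
  toQ-mono-≤ (mkII (mkI a top p) s q) (mkII _ s' q') (inj₂ (refl , _)) = inj₂ (refl , lift _)
  toQ-mono-≤ (mkII (mkI a (el l) p) s q) (mkII _ s' q') (inj₂ (refl , s≤s')) =
    inj₂ (refl , inj₂ (refl , s≤s'))

  toQ-cancel-≤ : ∀ x y → toQ x Q.≤ toQ y → x P.≤ y
  toQ-cancel-≤ (mkII (mkI _ _ _) _ _) (mkII (mkI _ _ _) _ _) (inj₁ a<a') =
    inj₁ (inj₁ a<a' , λ c≡c' → proj₂ a<a' (cong TypeICarrier.fst c≡c'))
  toQ-cancel-≤ (mkII (mkI a bot p) s q) (mkII (mkI _ bot p') top q') (inj₂ (refl , _)) =
    inj₂ (refl , lift _)
  toQ-cancel-≤ (mkII (mkI a bot p) s q) (mkII (mkI a' bot p') (el b) q') (inj₂ _) =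
    ⊥-elim (no-el-over-bot a' p' b q')
  toQ-cancel-≤ (mkII (mkI a bot p) s q) (mkII (mkI _ top p') s' q') (inj₂ (refl , _)) =
    inj₁ (inj₂ (refl , lift _) , λ ())
  toQ-cancel-≤ (mkII (mkI a bot p) s q) (mkII (mkI _ (el _) p') s' q') (inj₂ (refl , _)) =
    inj₁ (inj₂ (refl , lift _) , λ ())
  toQ-cancel-≤ (mkII (mkI a top p) s q) (mkII (mkI _ bot p') s' q') (inj₂ (refl , lift ()))
  toQ-cancel-≤ (mkII (mkI a top p) s q) (mkII (mkI _ top p') top q') (inj₂ (refl , _)) =
    inj₂ (refl , lift _)
  toQ-cancel-≤ (mkII (mkI a top p) s q) (mkII (mkI a' top p') (el b) q') (inj₂ _) =
    ⊥-elim (no-el-over-top a' p' b q')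
  toQ-cancel-≤ (mkII (mkI a top p) s q) (mkII (mkI _ (el _) p') s' q') (inj₂ (refl , lift ()))
  toQ-cancel-≤ (mkII (mkI a (el l) p) s q) (mkII (mkI _ bot p') s' q') (inj₂ (refl , lift ()))
  toQ-cancel-≤ (mkII (mkI a (el l) p) s q) (mkII (mkI _ top p') s' q') (inj₂ (refl , _)) =
    inj₁ (inj₂ (refl , lift _) , λ ())
  toQ-cancel-≤ (mkII (mkI a (el l) p) s q) (mkII (mkI _ (el l') p') s' q') (inj₂ (refl , inj₁ (l≤l' , l≢l'))) =
    inj₁ (inj₂ (refl , l≤l') , λ c≡c' → l≢l' (el-injective (cong TypeICarrier.snd c≡c')))
  toQ-cancel-≤ (mkII (mkI a (el l) p) s q) (mkII (mkI _ (el _) p') s' q') (inj₂ (refl , inj₂ (refl , s≤s'))) =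
    inj₂ (refl , s≤s')

  e-of : P.Carrier → Ext₂ L.Carrier
  e-of x = TypeICarrier.snd (TypeIICarrier.fst x)

  s-of : P.Carrier → Ext₁ B.Carrier
  s-of = TypeIICarrier.snd

  τ-of : P.Carrier → Ext₂ M.Carrier
  τ-of x = TypeICarrier.snd (toQ x)

  τ≡bot⇔ : ∀ z → (e-of z ≡ bot × s-of z ≡ top) ⇔ (τ-of z ≡ bot)
  τ≡bot⇔ (mkII (mkI a bot p) top q) = mk⇔ (λ _ → refl) (λ _ → refl , refl)
  τ≡bot⇔ (mkII (mkI a bot p) (el b) q) = ⊥-elim (no-el-over-bot a p b q)
  τ≡bot⇔ (mkII (mkI a top p) s q) = mk⇔ (λ { (() , _) }) (λ ())
  τ≡bot⇔ (mkII (mkI a (el _) p) s q) = mk⇔ (λ { (() , _) }) (λ ())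

  τ≡top⇔ : ∀ z → (e-of z ≡ top × s-of z ≡ top) ⇔ (τ-of z ≡ top)
  τ≡top⇔ (mkII (mkI a top p) top q) = mk⇔ (λ _ → refl) (λ _ → refl , refl)
  τ≡top⇔ (mkII (mkI a top p) (el b) q) = ⊥-elim (no-el-over-top a p b q)
  τ≡top⇔ (mkII (mkI a bot p) s q) = mk⇔ (λ { (() , _) }) (λ ())
  τ≡top⇔ (mkII (mkI a (el _) p) s q) = mk⇔ (λ { (() , _) }) (λ ())

  Mul-snd⇔ : ∀ x y z →
    (Mul₂ (rel L) (e-of x) (e-of y) (e-of z) × Mul₁ (rel B) (s-of x) (s-of y) (s-of z))
    ⇔ Mul₂ M (τ-of x) (τ-of y) (τ-of z)
  Mul-snd⇔ (mkII (mkI a bot p) top q) y z = τ≡bot⇔ z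
  Mul-snd⇔ (mkII (mkI a bot p) (el b) q) y z = ⊥-elim (no-el-over-bot a p b q)
  Mul-snd⇔ (mkII (mkI a top p) (el b) q) y z = ⊥-elim (no-el-over-top a p b q)
  Mul-snd⇔ (mkII (mkI a top p) top q) (mkII (mkI a₂ bot p₂) s₂ q₂) z = τ≡bot⇔ z
  Mul-snd⇔ (mkII (mkI a top p) top q) (mkII (mkI a₂ top p₂) s₂ q₂) z = τ≡top⇔ z
  Mul-snd⇔ (mkII (mkI a top p) top q) (mkII (mkI a₂ (el _) p₂) s₂ q₂) z = τ≡top⇔ z
  Mul-snd⇔ (mkII (mkI a (el l) p) top q) (mkII (mkI a₂ bot p₂) s₂ q₂) z = τ≡bot⇔ z
  Mul-snd⇔ (mkII (mkI a (el l) p) (el b) q) (mkII (mkI a₂ bot p₂) top q₂) z = τ≡bot⇔ z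
  Mul-snd⇔ (mkII (mkI a (el l) p) (el b) q) (mkII (mkI a₂ bot p₂) (el b₂) q₂) z =
    ⊥-elim (no-el-over-bot a₂ p₂ b₂ q₂)
  Mul-snd⇔ (mkII (mkI a (el l) p) top q) (mkII (mkI a₂ top p₂) s₂ q₂) z = τ≡top⇔ z
  Mul-snd⇔ (mkII (mkI a (el l) p) (el b) q) (mkII (mkI a₂ top p₂) top q₂) z = τ≡top⇔ z
  Mul-snd⇔ (mkII (mkI a (el l) p) (el b) q) (mkII (mkI a₂ top p₂) (el b₂) q₂) z =
    ⊥-elim (no-el-over-top a₂ p₂ b₂ q₂)
  Mul-snd⇔ (mkII (mkI a (el l) p) s q) (mkII (mkI a₂ (el l₂) p₂) s₂ q₂) (mkII (mkI a₃ bot p₃) s₃ q₃) =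
    mk⇔ (λ { (lift () , _) }) (λ { (lift ()) })
  Mul-snd⇔ (mkII (mkI a (el l) p) s q) (mkII (mkI a₂ (el l₂) p₂) s₂ q₂) (mkII (mkI a₃ top p₃) s₃ q₃) =
    mk⇔ (λ { (lift () , _) }) (λ { (lift ()) })
  Mul-snd⇔ (mkII (mkI a (el l) p) s q) (mkII (mkI a₂ (el l₂) p₂) s₂ q₂) (mkII (mkI a₃ (el l₃) p₃) s₃ q₃) =
    mk⇔ (λ m → m) (λ m → m)

  Mul⇔ : ∀ x y z → P.Mul x y z ⇔ Q.Mul (toQ x) (toQ y) (toQ z)
  Mul⇔ x y z = mk⇔
    (λ ((a*a'≡a'' , e-mul) , s-mul) → a*a'≡a'' , to (Mul-snd⇔ x y z) (e-mul , s-mul))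
    (λ (a*a'≡a'' , τ-mul) → let (e-mul , s-mul) = from (Mul-snd⇔ x y z) τ-mul
                             in (a*a'≡a'' , e-mul) , s-mul)

  NegP : P.Carrier → P.Carrier → Set ℓ
  NegP = NegII C (rel B) (gr-tC A L H sub) (gr-fC A L H sub oA oL)

  NegQ : Q.Carrier → Q.Carrier → Set ℓ
  NegQ = NegI (rel A) H M t-closed f-closed

  CNeg : ∀ c d → C.Neg c d ⇔ NegC c d
  CNeg = Neg⇔NegI oA oL

  MNeg : ∀ m m' → M.Neg m m' ⇔ NegM m m'
  MNeg = Neg⇔NegII oB

  NegP-¬Gr : ∀ c .q n → ¬ C.Gr c → NegP (mkII c top q) n ⇔ (s-of n ≡ top × NegC c (TypeIICarrier.fst n))
  NegP-¬Gr c q n ¬gc = mk⇔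
    (λ where (s≡top , inj₁ (_ , ¬c≡c')) → s≡top , to (CNeg c c') ¬c≡c'
             (_ , inj₂ (gc , _)) → Empty.⊥-elim (¬gc gc))
    (λ (s≡top , ¬c≡c') → s≡top , inj₁ (¬gc , from (CNeg c c') ¬c≡c'))
    where c' = TypeIICarrier.fst n

  private
    rearrange : ∀ {S X₁ X₂ N E₁ E₂ T₁ T₂ : Set ℓ} → (E₁ × S) ⇔ T₁ → (E₂ × S) ⇔ T₂
              → (S × ((X₁ × N × E₁) ⊎ (X₂ × N × E₂))) ⇔ ((X₁ × N × T₁) ⊎ (X₂ × N × T₂))
    rearrange E₁⇔T₁ E₂⇔T₂ = mk⇔
      (λ where (s , inj₁ (x , n , e)) → inj₁ (x , n , to E₁⇔T₁ (e , s))
               (s , inj₂ (x , n , e)) → inj₂ (x , n , to E₂⇔T₂ (e , s)))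
      (λ where (inj₁ (x , n , t)) → let (e , s) = from E₁⇔T₁ t in s , inj₁ (x , n , e)
               (inj₂ (x , n , t)) → let (e , s) = from E₂⇔T₂ t in s , inj₂ (x , n , e))

  Neg⇔-bot : ∀ a .p .q n → NegP (mkII (mkI a bot p) top q) n
                          ⇔ NegQ (toQ (mkII (mkI a bot p) top q)) (toQ n)
  Neg⇔-bot a p q n =
    ⇔-trans (NegP-¬Gr (mkI a bot p) q n (¬Gr-bot a p)) (rearrange (τ≡bot⇔ n) (τ≡top⇔ n))

  Neg⇔-top : ∀ a .p .q n → NegP (mkII (mkI a top p) top q) n
                          ⇔ NegQ (toQ (mkII (mkI a top p) top q)) (toQ n)
  Neg⇔-top a p q n =
    ⇔-trans (NegP-¬Gr (mkI a top p) q n (¬Gr-top a p)) (rearrange (τ≡bot⇔ n) (τ≡bot⇔ n))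

  Neg₂-el-el : ∀ l b .r n →
    (Neg₂ (rel L) (el l) (e-of n) × Σ[ b' ∈ B.Carrier ] (s-of n ≡ el b' × RB.Neg b b'))
    ⇔ Neg₂ M (el (mkII l (el b) r)) (τ-of n)
  Neg₂-el-el l b r (mkII (mkI a' bot p') s' q') = mk⇔ (λ { (lift () , _) }) (λ { (lift ()) })
  Neg₂-el-el l b r (mkII (mkI a' top p') s' q') = mk⇔ (λ { (lift () , _) }) (λ { (lift ()) })
  Neg₂-el-el l b r (mkII (mkI a' (el l') p') s' q') =
    ⇔-sym (MNeg (mkII l (el b) r) (mkII l' s' (Gr-C⇒Gr-L a' l' p' q')))

  Neg⇔-el-el : ∀ a l b .p .q n → NegP (mkII (mkI a (el l) p) (el b) q) n
                                ⇔ NegQ (toQ (mkII (mkI a (el l) p) (el b) q)) (toQ n)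
  Neg⇔-el-el a l b p q n = mk⇔
    (λ (¬c≡c' , ¬b≡b') → case to (CNeg c c') ¬c≡c' of λ where
       (inj₁ (¬h , _)) → ⊥-elim (¬h (V-of-el p))
       (inj₂ (h , ¬a≡a' , ¬l≡e')) →
         inj₂ (h , ¬a≡a' , to (Neg₂-el-el l b (Gr-C⇒Gr-L a l p q) n) (¬l≡e' , ¬b≡b')))
    (λ where
       (inj₁ (¬h , _)) → ⊥-elim (¬h (V-of-el p))
       (inj₂ (h , ¬a≡a' , ¬m≡τ)) →
         let (¬l≡e' , ¬b≡b') = from (Neg₂-el-el l b (Gr-C⇒Gr-L a l p q) n) ¬m≡τ
         in from (CNeg c c') (inj₂ (h , ¬a≡a' , ¬l≡e')) , ¬b≡b')
    where
    c = mkI a (el l) p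
    c' = TypeIICarrier.fst n

  module _ (wdL : TypeII-WellDefined (rel L)) where

    -- (¬c)↓ is (¬a, (¬l)↓): since ¬l ∈ L_gr it has a predecessor in L, which stays one in C.
    Down-after-Neg : ∀ a l .p d c' → C.Gr (mkI a (el l) p) → NegC (mkI a (el l) p) d → Down C d c'
      → H a × RA.Neg a (TypeICarrier.fst c')
        × Σ[ k ∈ L.Carrier ] (RL.Neg l k
          × Σ[ k' ∈ L.Carrier ] (TypeICarrier.snd c' ≡ el k' × Down (rel L) k k'))
    Down-after-Neg a l p d c' gc (inj₁ (¬h , _)) d↓ = ⊥-elim (¬h (V-of-el p))
    Down-after-Neg a l p (mkI _ bot _) c' gc (inj₂ (_ , _ , lift ())) d↓
    Down-after-Neg a l p (mkI _ top _) c' gc (inj₂ (_ , _ , lift ())) d↓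
    Down-after-Neg a l p (mkI a'' (el k) r) c' gc (inj₂ (h , ¬a≡a'' , ¬l≡k)) d↓
      with Down-el⇒ wdL {a''} {k} {r} c' (subst RL.Gr ¬l≡k (PL.Gr-¬ oL (Gr-snd a l p gc))) d↓
    ... | a'≡a'' , k' , e'≡k' , k↓ =
      h , subst (RA.Neg a) (sym a'≡a'') ¬a≡a'' , k , ¬l≡k , k' , e'≡k' , k↓

    Neg⇔-el-top : ∀ a l .p .q n → NegP (mkII (mkI a (el l) p) top q) n
                                 ⇔ NegQ (toQ (mkII (mkI a (el l) p) top q)) (toQ n)
    Neg⇔-el-top a l p q n@(mkII (mkI a' (el l') p') s' q') = mk⇔ to' from'
      where
      c = mkI a (el l) p
      c' = mkI a' (el l') p'
      m m' : M.Carrier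
      m = mkII l top (Gr-C⇒Gr-L a l p q)
      m' = mkII l' s' (Gr-C⇒Gr-L a' l' p' q')

      to' : NegP (mkII c top q) n → NegQ (toQ (mkII c top q)) (toQ n)
      to' (s'≡top , inj₁ (¬gc , ¬c≡c')) with to (CNeg c c') ¬c≡c'
      ... | inj₁ (¬h , _) = ⊥-elim (¬h (V-of-el p))
      ... | inj₂ (h , ¬a≡a' , ¬l≡l') = inj₂ (h , ¬a≡a' , from (MNeg m m')
              (s'≡top , inj₁ ((λ gl → ¬gc (Gr-intro oA a l p (inGr h) gl)) , ¬l≡l')))
      to' (s'≡top , inj₂ (gc , d , ¬c≡d , d↓)) with Down-after-Neg a l p d c' gc (to (CNeg c d) ¬c≡d) d↓
      ... | h , ¬a≡a' , k , ¬l≡k , _ , refl , k↓ = inj₂ (h , ¬a≡a' , from (MNeg m m')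
              (s'≡top , inj₂ (Gr-snd a l p gc , k , ¬l≡k , k↓)))

      from' : NegQ (toQ (mkII c top q)) (toQ n) → NegP (mkII c top q) n
      from' (inj₁ (¬h , _)) = ⊥-elim (¬h (V-of-el p))
      from' (inj₂ (h , ¬a≡a' , ¬m≡m')) with to (MNeg m m') ¬m≡m'
      ... | s'≡top , inj₁ (¬gl , ¬l≡l') =
        s'≡top , inj₁ ((λ gc → ¬gl (Gr-snd a l p gc)) , from (CNeg c c') (inj₂ (h , ¬a≡a' , ¬l≡l')))
      ... | s'≡top , inj₂ (gl , k , ¬l≡k , k↓) =
        s'≡top , inj₂ (Gr-intro oA a l p (inGr h) gl , d , from (CNeg c d) (inj₂ (h , ¬a≡a' , ¬l≡k)) ,
                       Down-el⇐ wdL (subst RL.Gr ¬l≡k (PL.Gr-¬ oL gl)) k↓)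
        where
        d : C.Carrier
        d = mkI a' (el k) (inj₂ (V-of-el p'))
    Neg⇔-el-top a l p q n@(mkII (mkI a' bot p') s' q') = mk⇔ to' from'
      where
      c = mkI a (el l) p
      to' : NegP (mkII c top q) n → NegQ (toQ (mkII c top q)) (toQ n)
      to' (_ , inj₁ (_ , ¬c≡c')) with to (CNeg c (mkI a' bot p')) ¬c≡c'
      ... | inj₁ (¬h , _) = ⊥-elim (¬h (V-of-el p))
      ... | inj₂ (_ , _ , lift ())
      to' (_ , inj₂ (gc , d , ¬c≡d , d↓))
        with Down-after-Neg a l p d (mkI a' bot p') gc (to (CNeg c d) ¬c≡d) d↓
      ... | _ , _ , _ , _ , _ , () , _
      from' : NegQ (toQ (mkII c top q)) (toQ n) → NegP (mkII c top q) n
      from' (inj₁ (¬h , _)) = ⊥-elim (¬h (V-of-el p))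
      from' (inj₂ (_ , _ , lift ()))
    Neg⇔-el-top a l p q n@(mkII (mkI a' top p') s' q') = mk⇔ to' from'
      where
      c = mkI a (el l) p
      to' : NegP (mkII c top q) n → NegQ (toQ (mkII c top q)) (toQ n)
      to' (_ , inj₁ (_ , ¬c≡c')) with to (CNeg c (mkI a' top p')) ¬c≡c'
      ... | inj₁ (¬h , _) = ⊥-elim (¬h (V-of-el p))
      ... | inj₂ (_ , _ , lift ())
      to' (_ , inj₂ (gc , d , ¬c≡d , d↓))
        with Down-after-Neg a l p d (mkI a' top p') gc (to (CNeg c d) ¬c≡d) d↓
      ... | _ , _ , _ , _ , _ , () , _
      from' : NegQ (toQ (mkII c top q)) (toQ n) → NegP (mkII c top q) n
      from' (inj₁ (¬h , _)) = ⊥-elim (¬h (V-of-el p))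
      from' (inj₂ (_ , _ , lift ()))

    Neg⇔ : ∀ y n → NegP y n ⇔ NegQ (toQ y) (toQ n)
    Neg⇔ (mkII (mkI a bot p) top q) = Neg⇔-bot a p q
    Neg⇔ (mkII (mkI a bot p) (el b) q) = ⊥-elim (no-el-over-bot a p b q)
    Neg⇔ (mkII (mkI a top p) top q) = Neg⇔-top a p q
    Neg⇔ (mkII (mkI a top p) (el b) q) = ⊥-elim (no-el-over-top a p b q)
    Neg⇔ (mkII (mkI a (el l) p) top q) = Neg⇔-el-top a l p q
    Neg⇔ (mkII (mkI a (el l) p) (el b) q) = Neg⇔-el-el a l b p q

    P≅Q : P ≅ Q
    P≅Q = record
      { to = toQ
      ; from = fromQ
      ; from∘to = fromQ∘toQ
      ; to∘from = toQ∘fromQ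
      ; ≤-iff = λ x y → mk⇔ (toQ-mono-≤ x y) (toQ-cancel-≤ x y)
      ; mul-iff = Mul⇔
      ; imp-iff = Residual-transport {NegP = NegP} {MulP = P.Mul} {NegQ = NegQ} {MulQ = Q.Mul}
                    toQ fromQ toQ∘fromQ Neg⇔ Mul⇔
      ; unit-pres = refl
      ; fal-pres = refl
      }

lemma2 : ∀ {ℓ} (A L B : FLe ℓ) (H : FLe.Carrier A → Set ℓ)
         → (oA : Odd A) (oL : Odd L) (oB : Odd B)
         → (sub : SubalgebraOfGr A H)
         → (TypeII-WellDefined (C[A,H,L] A L H sub)
             ⇔ TypeII-WellDefined (rel L))
           × (TypeII-WellDefined (C[A,H,L] A L H sub)
             → TypeII-WellDefined (rel L)
             → (TypeII (C[A,H,L] A L H sub) (rel B)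
                  (gr-tC A L H sub) (gr-fC A L H sub oA oL))
               ≅ TypeI (rel A) H
                   (TypeII (rel L) (rel B) (gr-t L) (gr-f L oL))
                   (SubalgebraOfGr.t-closed sub) (SubalgebraOfGr.f-closed sub))
lemma2 A L B H oA oL oB sub =
  TypeIProduct.TypeII-WellDefined⇔ A L H sub oA ,
  λ _ wdL → Isomorphism.P≅Q A L B H oA oL oB sub wdL
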